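{- Let $\mathcal{G}=(\mathcal{X},\Sigma,\mathcal{P},S_0)$ be a proper GVAS. Then $\mathcal{G}$ is thin if and only if there is no nonterminal $X\in\mathcal{X}$ admitting a derivation $X\Rightarrow \alpha X\beta X\gamma$ for some strings $\alpha,\beta,\gamma\in(\mathcal{X}\cup\Sigma)^*$.
   Context: A GVAS $\mathcal{G}=(\mathcal{X},\Sigma,\mathcal{P},S_0)$ is a context-free grammar in Chomsky normal form whose terminals are integer vectors ($\Sigma\subseteq\mathbb{Z}^d$ finite), with rules of the form $X\to AB$ ($A,B\in\mathcal{X}$) or $X\to\mathbf{u}$ ($\mathbf{u}\in\Sigma$); proper means every symbol is derivable from $S_0$ and every nonterminal derives some word of terminals. The production graph has vertex set $\mathcal{X}\cup\Sigma$, edges $(X,A),(X,B)$ for every rule $X\to AB$ and $(X,\mathbf{u})$ for every rule $X\to\mathbf{u}$. A rule $X\to AB$ is nondegenerate if $X,A,B$ lie in the same strongly connected component of the production graph. $\mathcal{G}$ is thin if $\mathcal{P}$ contains no nondegenerate rule. -}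

module Defs where

open import Data.Nat using (ℕ)
open import Data.Integer using (ℤ)
open import Data.Fin using (Fin)
open import Data.Vec using (Vec)
open import Data.List using (List; []; _∷_; _++_; [_]; map)
open import Data.List.Membership.Propositional using (_∈_)
open import Data.Product using (Σ; ∃; ∃-syntax; _×_; _,_)
open import Relation.Nullary using (¬_)
open import Data.Empty using (⊥)
open import Relation.Binary.Construct.Closure.ReflexiveTransitive using (Star)
open import Function.Definitions using (Injective)
open import Relation.Binary.PropositionalEquality using (_≡_)

data Rule (n m : ℕ) : Set where
  bin  : (X A B : Fin n) → Rule n m
  term : (X : Fin n) (u : Fin m) → Rule n m

-- Nonterminals 𝒳 = Fin n, terminals Σ = Fin m, each terminal
-- symbol being (injectively) an integer vector in ℤ^d, so Σ is a finite
-- subset of ℤ^d.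
record GVAS : Set where
  field
    dim     : ℕ
    nNT     : ℕ
    nT      : ℕ
    vec     : Fin nT → Vec ℤ dim
    vec-inj : Injective _≡_ _≡_ vec
    rules   : List (Rule nNT nT)
    start   : Fin nNT

module _ (G : GVAS) where
  open GVAS G

  data Sym : Set where
    nt : Fin nNT → Sym
    tm : Fin nT → Sym

  rhs : Rule nNT nT → List Sym
  rhs (bin X A B) = nt A ∷ nt B ∷ []
  rhs (term X u)  = tm u ∷ []

  lhs : Rule nNT nT → Fin nNT
  lhs (bin X A B) = X
  lhs (term X u)  = X

  data _⇒_ : List Sym → List Sym → Set where
    step : ∀ (r : Rule nNT nT) → r ∈ rules → (α β : List Sym) →
           (α ++ nt (lhs r) ∷ β) ⇒ (α ++ rhs r ++ β)

  _⇒*_ : List Sym → List Sym → Set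
  _⇒*_ = Star _⇒_

  Proper : Set
  Proper =
    (∀ (s : Sym) → ∃[ α ] ∃[ β ] ([ nt start ] ⇒* (α ++ s ∷ β)))
    × (∀ (X : Fin nNT) → ∃[ w ] ([ nt X ] ⇒* map tm w))

  data Edge : Sym → Sym → Set where
    edgeˡ : ∀ {X A B} → bin X A B ∈ rules → Edge (nt X) (nt A)
    edgeʳ : ∀ {X A B} → bin X A B ∈ rules → Edge (nt X) (nt B)
    edgeᵗ : ∀ {X u}   → term X u ∈ rules  → Edge (nt X) (tm u)

  Reach : Sym → Sym → Set
  Reach = Star Edge

  SameSCC : Sym → Sym → Set
  SameSCC a b = Reach a b × Reach b a

  Nondegenerate : Rule nNT nT → Set
  Nondegenerate (bin X A B) = SameSCC (nt X) (nt A) × SameSCC (nt X) (nt B)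
  Nondegenerate (term X u)  = ⊥

  Thin : Set
  Thin = ∀ (r : Rule nNT nT) → r ∈ rules → ¬ Nondegenerate r

-- If a rule X → AB has A and B in the SCC of X, then X ⇒ AB and the paths
-- A ⇝ X and B ⇝ X in the production graph unfold into a derivation of a
-- sentential form containing X twice.  Conversely, fix X and call a symbol
-- *live* if it reaches X in the production graph.  In a derivation from X
-- every symbol is reachable from X, so the lhs of every applied rule is in
-- the SCC of X; thinness then says that no applied rule has two live
-- symbols on its right-hand side, while a live symbol on the right makes
-- the lhs live.  Hence "two live occurrences" is reflected by each step,
-- and propagates back to the one-symbol form X: impossible.
module Submission where

open import Level using (Level; _⊔_)
open import Defs
open import Data.Fin using (Fin)
open import Data.List using (List; []; _∷_; _++_; [_])
open import Data.List.Properties using (++-assoc; ++-identityʳ)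
open import Data.List.Membership.Propositional using (_∈_)
open import Data.List.Relation.Unary.Any using (Any; here; there)
open import Data.List.Relation.Unary.Any.Properties as Any using ()
open import Data.List.Relation.Unary.All using (All; []; _∷_)
open import Data.List.Relation.Unary.All.Properties as All using ()
open import Data.Product using (∃-syntax; _,_; _×_)
open import Data.Sum using (_⊎_; inj₁; inj₂)
open import Data.Empty using (⊥-elim)
open import Relation.Nullary using (¬_)
open import Relation.Unary using (Pred)
open import Function.Bundles using (_⇔_; mk⇔)
open import Relation.Binary.PropositionalEquality using (_≡_; refl; subst; subst₂; cong; module ≡-Reasoning)
open import Relation.Binary.Construct.Closure.ReflexiveTransitive using (ε; _◅_; _◅◅_)

data Two {a p : Level} {A : Set a} (P : Pred A p) : List A → Set (a ⊔ p) where
  here  : ∀ {x xs} → P x → Any P xs → Two P (x ∷ xs)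
  there : ∀ {x xs} → Two P xs → Two P (x ∷ xs)

module _ {a p : Level} {A : Set a} {P : Pred A p} where

  ¬Two-[_] : ∀ x → ¬ Two P [ x ]
  ¬Two-[ x ] (here _ ())
  ¬Two-[ x ] (there ())

  Two-++⁺ˡ : ∀ {xs} ys → Two P xs → Two P (xs ++ ys)
  Two-++⁺ˡ ys (here px pxs) = here px (Any.++⁺ˡ pxs)
  Two-++⁺ˡ ys (there t)     = there (Two-++⁺ˡ ys t)

  Two-++⁺ʳ : ∀ xs {ys} → Two P ys → Two P (xs ++ ys)
  Two-++⁺ʳ []       t = t
  Two-++⁺ʳ (x ∷ xs) t = there (Two-++⁺ʳ xs t)

  Two-++⁺ : ∀ {xs} ys → Any P xs → Any P ys → Two P (xs ++ ys)
  Two-++⁺ ys (here px)  pys = here px (Any.++⁺ʳ _ pys)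
  Two-++⁺ ys (there ps) pys = there (Two-++⁺ ys ps pys)

  Two-++⁻ : ∀ xs {ys} → Two P (xs ++ ys) → Two P xs ⊎ (Any P xs × Any P ys) ⊎ Two P ys
  Two-++⁻ []       t = inj₂ (inj₂ t)
  Two-++⁻ (x ∷ xs) (here px ps) with Any.++⁻ xs ps
  ... | inj₁ pxs = inj₁ (here px pxs)
  ... | inj₂ pys = inj₂ (inj₁ (here px , pys))
  Two-++⁻ (x ∷ xs) (there t) with Two-++⁻ xs t
  ... | inj₁ txs                = inj₁ (there txs)
  ... | inj₂ (inj₁ (pxs , pys)) = inj₂ (inj₁ (there pxs , pys))
  ... | inj₂ (inj₂ tys)         = inj₂ (inj₂ tys)

  Two-contract : ∀ xs {ws y ys} → (Any P ws → P y) → ¬ Two P ws →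
                 Two P (xs ++ ws ++ ys) → Two P (xs ++ y ∷ ys)
  Two-contract xs {ws} collapse ¬two t with Two-++⁻ xs t
  ... | inj₁ txs = Two-++⁺ˡ _ txs
  ... | inj₂ (inj₁ (pxs , pws++ys)) with Any.++⁻ ws pws++ys
  ...   | inj₁ pws = Two-++⁺ _ pxs (here (collapse pws))
  ...   | inj₂ pys = Two-++⁺ _ pxs (there pys)
  Two-contract xs {ws} collapse ¬two t | inj₂ (inj₂ t′) with Two-++⁻ ws t′
  ... | inj₁ tws                = ⊥-elim (¬two tws)
  ... | inj₂ (inj₁ (pws , pys)) = Two-++⁺ʳ xs (here (collapse pws) pys)
  ... | inj₂ (inj₂ tys)         = Two-++⁺ʳ xs (there tys)

module _ (G : GVAS) where
  open GVAS G

  DoublySelfEmbedding : Fin nNT → Set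
  DoublySelfEmbedding X =
    ∃[ α ] ∃[ β ] ∃[ γ ] _⇒*_ G [ nt X ] (α ++ nt X ∷ β ++ nt X ∷ γ)

  ReachesTo : Sym G → Pred (Sym G) _
  ReachesTo t s = Reach G s t

  Reach-tm⇒≡ : ∀ {u s} → Reach G (tm u) s → tm u ≡ s
  Reach-tm⇒≡ ε       = refl
  Reach-tm⇒≡ (() ◅ _)

  rhs-reaches⇒lhs-reaches : ∀ {r t} → r ∈ rules →
                            Any (ReachesTo t) (rhs G r) → Reach G (nt (lhs G r)) t
  rhs-reaches⇒lhs-reaches {bin X A B} r∈ (here p)         = edgeˡ r∈ ◅ p
  rhs-reaches⇒lhs-reaches {bin X A B} r∈ (there (here p)) = edgeʳ r∈ ◅ p
  rhs-reaches⇒lhs-reaches {term X u}  r∈ (here p)         = edgeᵗ r∈ ◅ p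

  lhs-reachable⇒rhs-reachable : ∀ {r s} → r ∈ rules →
                                Reach G s (nt (lhs G r)) → All (Reach G s) (rhs G r)
  lhs-reachable⇒rhs-reachable {bin X A B} r∈ q =
    (q ◅◅ edgeˡ r∈ ◅ ε) ∷ (q ◅◅ edgeʳ r∈ ◅ ε) ∷ []
  lhs-reachable⇒rhs-reachable {term X u} r∈ q = (q ◅◅ edgeᵗ r∈ ◅ ε) ∷ []

  thin⇒¬Two-rhs : Thin G → ∀ {r t} → r ∈ rules → Reach G t (nt (lhs G r)) →
                  ¬ Two (ReachesTo t) (rhs G r)
  thin⇒¬Two-rhs thin {bin X A B} r∈ q (here pA (here pB)) =
    thin _ r∈ ((edgeˡ r∈ ◅ ε , pA ◅◅ q) , (edgeʳ r∈ ◅ ε , pB ◅◅ q))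
  thin⇒¬Two-rhs thin {bin X A B} r∈ q (there t) = ¬Two-[ nt B ] t
  thin⇒¬Two-rhs thin {term X u} r∈ q t = ¬Two-[ tm u ] t

  ⇒-preserves-All-reachable : ∀ {s u v} → _⇒_ G u v → All (Reach G s) u → All (Reach G s) v
  ⇒-preserves-All-reachable (step r r∈ α β) all with All.++⁻ α all
  ... | allα , qX ∷ allβ =
    All.++⁺ allα (All.++⁺ (lhs-reachable⇒rhs-reachable r∈ qX) allβ)

  thin⇒⇒-reflects-Two : Thin G → ∀ {t u v} → _⇒_ G u v → All (Reach G t) u →
                        Two (ReachesTo t) v → Two (ReachesTo t) u
  thin⇒⇒-reflects-Two thin (step r r∈ α β) all with All.++⁻ʳ α all
  ... | qX ∷ _ = Two-contract α (rhs-reaches⇒lhs-reaches r∈) (thin⇒¬Two-rhs thin r∈ qX)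

  thin⇒⇒*-reflects-Two : Thin G → ∀ {t u v} → _⇒*_ G u v → All (Reach G t) u →
                         Two (ReachesTo t) v → Two (ReachesTo t) u
  thin⇒⇒*-reflects-Two thin ε          all two = two
  thin⇒⇒*-reflects-Two thin (s ◅ steps) all two =
    thin⇒⇒-reflects-Two thin s all
      (thin⇒⇒*-reflects-Two thin steps (⇒-preserves-All-reachable s all) two)

  thin⇒¬DoublySelfEmbedding : Thin G → ∀ X → ¬ DoublySelfEmbedding X
  thin⇒¬DoublySelfEmbedding thin X (α , β , γ , derivation) =
    ¬Two-[ nt X ] (thin⇒⇒*-reflects-Two thin derivation (ε ∷ []) twoX)
    where
    twoX : Two (ReachesTo (nt X)) (α ++ nt X ∷ β ++ nt X ∷ γ)
    twoX = Two-++⁺ʳ α (here ε (Any.++⁺ʳ β (here ε)))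

  ⇒-cong : ∀ p q {u v} → _⇒_ G u v → _⇒_ G (p ++ u ++ q) (p ++ v ++ q)
  ⇒-cong p q (step r r∈ α β) =
    subst₂ (_⇒_ G) (reassoc [ nt (lhs G r) ]) (reassoc (rhs G r)) (step r r∈ (p ++ α) (β ++ q))
    where
    open ≡-Reasoning
    reassoc : ∀ w → (p ++ α) ++ w ++ β ++ q ≡ p ++ (α ++ w ++ β) ++ q
    reassoc w = begin
      (p ++ α) ++ w ++ β ++ q   ≡⟨ ++-assoc p α _ ⟩
      p ++ α ++ w ++ β ++ q     ≡⟨ cong (λ z → p ++ α ++ z) (++-assoc w β q) ⟨
      p ++ α ++ (w ++ β) ++ q   ≡⟨ cong (p ++_) (++-assoc α (w ++ β) q) ⟨
      p ++ (α ++ w ++ β) ++ q   ∎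

  ⇒*-cong : ∀ p q {u v} → _⇒*_ G u v → _⇒*_ G (p ++ u ++ q) (p ++ v ++ q)
  ⇒*-cong p q ε           = ε
  ⇒*-cong p q (s ◅ steps) = ⇒-cong p q s ◅ ⇒*-cong p q steps

  Reach⇒⇒* : ∀ {Z W} → Reach G (nt Z) (nt W) → ∃[ α ] ∃[ β ] _⇒*_ G [ nt Z ] (α ++ nt W ∷ β)
  Reach⇒⇒* ε = [] , [] , ε
  Reach⇒⇒* (edgeᵗ r∈ ◅ path) with () ← Reach-tm⇒≡ path
  Reach⇒⇒* (edgeˡ {B = B} r∈ ◅ path) with α , β , derivation ← Reach⇒⇒* path =
    α , β ++ [ nt B ] ,
    step _ r∈ [] [] ◅ subst (_⇒*_ G _) (++-assoc α _ [ nt B ]) (⇒*-cong [] [ nt B ] derivation)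
  Reach⇒⇒* (edgeʳ {A = A} r∈ ◅ path) with α , β , derivation ← Reach⇒⇒* path =
    nt A ∷ α , β ,
    step _ r∈ [] [] ◅ subst (_⇒*_ G _) (cong (nt A ∷_) (++-identityʳ (α ++ _)))
                                       (⇒*-cong [ nt A ] [] derivation)

  Nondegenerate⇒DoublySelfEmbedding : ∀ {r} → r ∈ rules → Nondegenerate G r →
                                      ∃[ X ] DoublySelfEmbedding X
  Nondegenerate⇒DoublySelfEmbedding {bin X A B} r∈ ((_ , A⇝X) , (_ , B⇝X))
    with α₁ , β₁ , A⇒*X ← Reach⇒⇒* A⇝X | α₂ , β₂ , B⇒*X ← Reach⇒⇒* B⇝X =
    X , α₁ , β₁ ++ α₂ , β₂ ,
    step _ r∈ [] [] ◅ subst (_⇒*_ G _) reassoc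
      (⇒*-cong [] [ nt B ] A⇒*X ◅◅ ⇒*-cong (α₁ ++ nt X ∷ β₁) [] B⇒*X)
    where
    reassoc : (α₁ ++ nt X ∷ β₁) ++ (α₂ ++ nt X ∷ β₂) ++ [] ≡ α₁ ++ nt X ∷ (β₁ ++ α₂) ++ nt X ∷ β₂
    reassoc rewrite ++-identityʳ (α₂ ++ nt X ∷ β₂)
                  | ++-assoc α₁ (nt X ∷ β₁) (α₂ ++ nt X ∷ β₂)
                  | ++-assoc β₁ α₂ (nt X ∷ β₂) = refl

lemmaA1 : (G : GVAS) → Proper G →
    (Thin G ⇔ (¬ (∃[ X ] ∃[ α ] ∃[ β ] ∃[ γ ]
    _⇒*_ G [ nt X ] (α ++ nt X ∷ β ++ nt X ∷ γ))))
lemmaA1 G _ = mk⇔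
  (λ thin (X , embedding) → thin⇒¬DoublySelfEmbedding G thin X embedding)
  (λ noEmbedding r r∈ nondegenerate →
     noEmbedding (Nondegenerate⇒DoublySelfEmbedding G r∈ nondegenerate))
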